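{- None of the $L_{\mathcal{O}}^p$-theories $T\big((\vec{0},\vec{0}),(\vec{0},\vec{0})\big)$, $T\big((\vec{0},\vec{\infty}),(\vec{0},\vec{0})\big)$, $T\big((\vec{0},\vec{\infty}),(\vec{0},\vec{\infty})\big)$ is dp-minimal.
   Context: An oriented abelian group is an abelian group $(A,+,-,0)$ with a ternary relation $\mathcal{O}$ which is a translation-invariant cyclic order: for all $a,b,c,d$, $\mathcal{O}(a,b,c)\to\mathcal{O}(b,c,a)$; $\mathcal{O}(a,b,c)\to\neg\mathcal{O}(c,b,a)$; $\mathcal{O}(a,b,c)\wedge\mathcal{O}(a,c,d)\to\mathcal{O}(a,b,d)$; for pairwise distinct $a,b,c$, $\mathcal{O}(a,b,c)\vee\mathcal{O}(c,b,a)$; $\mathcal{O}(a,b,c)\to\mathcal{O}(a+d,b+d,c+d)$. Write $x<_0y$ for $x\neq y\wedge\mathcal{O}(0,x,y)$. Orientation intervals $(a,b)_{\mathcal{O}}=\{x:\mathcal{O}(a,x,b)\}$ form a basis of a group topology; "dense" refers to it. $A$ is regularly dense if for each prime $p$ and all $a,b$ with $\mathcal{O}(0,a,b)$ there is $c$ with $\mathcal{O}(a,pc,b)$ and $ic<_0(i+1)c$ for $i=1,\dots,p-1$. For a prime $p$, $[p]A=|A/pA|$, $\operatorname{Tor}_n(A)=\{a:na=0\}$, and $e(A,p)$ is the least $e\in\mathbb{N}$ with $\operatorname{Tor}_{p^{e+k}}(A)=\operatorname{Tor}_{p^e}(A)$ for all $k$ (where $\operatorname{Tor}_{p^0}(A)=\{0\}$),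 or $\infty$ if none exists. For sequences $\vec d,\vec e$ indexed by primes $p_i$ with values in $\mathbb{N}\cup\{\infty\}$, $T(\vec d,\vec e)$ is the theory in $L_{\mathcal{O}}=\{+,-,0,\mathcal{O}\}$ whose models are regularly dense oriented abelian groups with $[p_i]A=p_i^{d_i}$ and $e(A,p_i)=e_i$; $\vec0,\vec\infty$ are constant sequences. $L^p_{\mathcal{O}}=L_{\mathcal{O}}\cup\{V\}$, $V$ unary. $T\big((\vec d_1,\vec e_1),(\vec d_2,\vec e_2)\big)$ is the (complete) $L^p_{\mathcal{O}}$-theory whose models are pairs $(A,G)$ ($V$ interpreted as $G$) with $A\models T(\vec d_1,\vec e_1)$, $G$ a dense subgroup of $A$ with $G\models T(\vec d_2,\vec e_2)$ in the induced structure, and $A/G$ infinite. -}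

module Defs where

open import Data.Nat using (ℕ; zero; suc; _+_; _^_; _≤_; _<_)
open import Data.Unit using (⊤)
open import Data.Nat.Primality using (Prime)
open import Data.Fin using (Fin; zero; suc)
open import Data.Product using (Σ; _×_; _,_; ∃)
open import Data.Empty using (⊥)
open import Data.Sum using (_⊎_)
open import Relation.Nullary using (¬_)
open import Relation.Binary.PropositionalEquality using (_≡_; _≢_)
open import Function.Bundles using (_⇔_)

record LStr : Set₁ where
  field
    Carrier : Set
    _⊕_     : Carrier → Carrier → Carrier
    ⊖_      : Carrier → Carrier
    𝟎       : Carrier
    Or      : Carrier → Carrier → Carrier → Set
    V       : Carrier → Set

  infixl 6 _⊕_

  _·_ : ℕ → Carrier → Carrier
  zero  · x = 𝟎
  suc n · x = x ⊕ (n · x)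

  _<₀_ : Carrier → Carrier → Set
  x <₀ y = (x ≢ y) × Or 𝟎 x y


record IsOrientedAbGroup (M : LStr) : Set where
  open LStr M
  field
    +-assoc   : ∀ a b c → (a ⊕ b) ⊕ c ≡ a ⊕ (b ⊕ c)
    +-comm    : ∀ a b → a ⊕ b ≡ b ⊕ a
    +-identity : ∀ a → a ⊕ 𝟎 ≡ a
    +-inverse : ∀ a → a ⊕ (⊖ a) ≡ 𝟎
    O-cyclic  : ∀ a b c → Or a b c → Or b c a
    O-asym    : ∀ a b c → Or a b c → ¬ Or c b a
    O-trans   : ∀ a b c d → Or a b c → Or a c d → Or a b d
    O-total   : ∀ a b c → a ≢ b → b ≢ c → a ≢ c → Or a b c ⊎ Or c b a
    O-transl  : ∀ a b c d → Or a b c → Or (a ⊕ d) (b ⊕ d) (c ⊕ d)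

-- Properties of A and of the induced structure on V (= G).
-- Everything is relativised to a predicate S on the carrier; for A
-- itself take S = λ _ → ⊤-like "InA", for G take S = V.

module _ (M : LStr) (S : LStr.Carrier M → Set) where
  open LStr M

  RegDenseIn : Set
  RegDenseIn = ∀ (p : ℕ) → Prime p → ∀ a b → S a → S b → Or 𝟎 a b →
    Σ Carrier λ c → S c × Or a (p · c) b ×
      (∀ (i : ℕ) → 1 ≤ i → i < p → (i · c) <₀ (suc i · c))

  -- [p]S = p^0 = 1, i.e. |S/pS| = 1, i.e. S = pS
  IndexOneIn : ℕ → Set
  IndexOneIn p = ∀ a → S a → Σ Carrier λ b → S b × (p · b ≡ a)

  TorEqIn : ℕ → ℕ → ℕ → Set
  TorEqIn p e k = ∀ x → S x → ((p ^ (e + k)) · x ≡ 𝟎) ⇔ ((p ^ e) · x ≡ 𝟎)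

  EZeroIn : ℕ → Set
  EZeroIn p = ∀ k → TorEqIn p 0 k

  EInftyIn : ℕ → Set
  EInftyIn p = ∀ e → ¬ (∀ k → TorEqIn p e k)

  Divisible : Set
  Divisible = ∀ p → Prime p → IndexOneIn p

  TorsionFreeE0 : Set
  TorsionFreeE0 = ∀ p → Prime p → EZeroIn p

  EInftyAll : Set
  EInftyAll = ∀ p → Prime p → EInftyIn p

module _ (M : LStr) where
  open LStr M

  All : Carrier → Set
  All _ = ⊤

  IsSubgroup : Set
  IsSubgroup = V 𝟎 × (∀ a b → V a → V b → V (a ⊕ b)) × (∀ a → V a → V (⊖ a))

  IsDenseV : Set
  IsDenseV = ∀ a b x → Or a x b → Σ Carrier λ g → V g × Or a g b

  -- A/G infinite: arbitrarily many pairwise incongruent elements mod G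
  InfiniteQuot : Set
  InfiniteQuot = ∀ (n : ℕ) → Σ (Fin n → Carrier) λ f →
    ∀ i j → i ≢ j → ¬ V (f i ⊕ (⊖ f j))

-- The three theories (classes of models).  d-vectors are all 0,
-- e-vectors are constantly 0 or constantly ∞.

data EVal : Set where
  e0 e∞ : EVal

ECond : (M : LStr) (S : LStr.Carrier M → Set) → EVal → Set
ECond M S e0 = TorsionFreeE0 M S
ECond M S e∞ = EInftyAll M S

record ModelT (e₁ e₂ : EVal) (M : LStr) : Set where
  field
    isOAG      : IsOrientedAbGroup M
    A-regdense : RegDenseIn M (All M)
    A-div      : Divisible M (All M)
    A-e        : ECond M (All M) e₁
    G-subgroup : IsSubgroup M
    G-dense    : IsDenseV M
    G-regdense : RegDenseIn M (LStr.V M)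
    G-div      : Divisible M (LStr.V M)
    G-e        : ECond M (LStr.V M) e₂
    quot-inf   : InfiniteQuot M

-- First-order L^p_O formulas (de Bruijn variables) and satisfaction.
-- Connectives: =, O, V, ¬, ∧, ∃ (others are classically definable).

data Term (n : ℕ) : Set where
  var  : Fin n → Term n
  zer  : Term n
  plus : Term n → Term n → Term n
  neg  : Term n → Term n

data Formula (n : ℕ) : Set where
  eqF  : Term n → Term n → Formula n
  ordF : Term n → Term n → Term n → Formula n
  vF   : Term n → Formula n
  notF : Formula n → Formula n
  andF : Formula n → Formula n → Formula n
  exF  : Formula (suc n) → Formula n

module _ (M : LStr) where
  open LStr M

  cons : ∀ {n} → Carrier → (Fin n → Carrier) → Fin (suc n) → Carrier
  cons a ρ zero    = a
  cons a ρ (suc i) = ρ i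

  evalT : ∀ {n} → (Fin n → Carrier) → Term n → Carrier
  evalT ρ (var i)    = ρ i
  evalT ρ zer        = 𝟎
  evalT ρ (plus s t) = evalT ρ s ⊕ evalT ρ t
  evalT ρ (neg t)    = ⊖ evalT ρ t

  Sat : ∀ {n} → (Fin n → Carrier) → Formula n → Set
  Sat ρ (eqF s t)     = evalT ρ s ≡ evalT ρ t
  Sat ρ (ordF s t u)  = Or (evalT ρ s) (evalT ρ t) (evalT ρ u)
  Sat ρ (vF t)        = V (evalT ρ t)
  Sat ρ (notF φ)      = Sat ρ φ → ⊥
  Sat ρ (andF φ ψ)    = Sat ρ φ × Sat ρ ψ
  Sat ρ (exF φ)       = Σ Carrier λ a → Sat (cons a ρ) φ

  -- ict-pattern of depth 2 in one object variable x (variable 0), with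
  -- parameter tuples ȳ of length m₁ and z̄ of length m₂, of every finite size n
  -- (by compactness, equivalent to an infinite ict-pattern in the monster model).
  NotDPMinimal : Set
  NotDPMinimal =
    Σ ℕ λ m₁ → Σ ℕ λ m₂ → Σ (Formula (suc m₁)) λ φ → Σ (Formula (suc m₂)) λ ψ →
      ∀ (n : ℕ) → Σ (Fin n → Fin m₁ → Carrier) λ b → Σ (Fin n → Fin m₂ → Carrier) λ c →
        ∀ (i j : Fin n) → Σ Carrier λ a →
          (∀ k → Sat (cons a (b k)) φ ⇔ (k ≡ i)) ×
          (∀ l → Sat (cons a (c l)) ψ ⇔ (l ≡ j))

-- φ(x; y₁, y₂) := O(y₁, x, y₂) and ψ(x; z) := x − z ∈ G form an ict-pattern of depth 2.
-- Because the cyclic order is dense (regular density for p = 2 suffices), a nonempty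
-- interval contains n pairwise disjoint nonempty subintervals; because A/G is infinite,
-- there are n pairwise incongruent elements d₁, …, dₙ modulo G; and because G is dense,
-- every coset dⱼ + G meets every nonempty interval.  A point of the i-th interval in the
-- j-th coset realises the pattern.
module Submission where

open import Defs
open import Data.Product using (Σ-syntax; _×_; _,_; proj₁; proj₂)
open import Data.Nat using (ℕ; zero; suc)
open import Data.Fin using (Fin; zero; suc; _≟_)
open import Data.Sum using (inj₁; inj₂)
open import Data.Vec.Functional using ([]; _∷_)
open import Data.Nat.Primality using (prime[2])
open import Relation.Nullary using (¬_; yes; no; contradiction)
open import Relation.Binary.PropositionalEquality
  using (_≡_; _≢_; refl; sym; cong; subst; subst₂; module ≡-Reasoning)
open import Function.Bundles using (mk⇔)

module CyclicOrder {A : Set} (Or : A → A → A → Set)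
  (cyclic : ∀ a b c → Or a b c → Or b c a)
  (asym : ∀ a b c → Or a b c → ¬ Or c b a)
  (transitive : ∀ a b c d → Or a b c → Or a c d → Or a b d)
  where

  private variable a b x y : A

  Dense : Set
  Dense = ∀ {e a b} → Or e a b → Σ[ y ∈ A ] Or a y b

  rotate : Or a x b → Or x b a
  rotate {a} {x} {b} = cyclic a x b

  lower-⊆ : Or a x b → Or a y x → Or a y b
  lower-⊆ {a} {x} {b} {y} a<x<b a<y<x = transitive a y x b a<y<x a<x<b

  upper-⊆ : Or a x b → Or x y b → Or a y b
  upper-⊆ {a} {x} {b} {y} a<x<b x<y<b =
    rotate (transitive b a x y (rotate (rotate a<x<b)) (rotate (rotate x<y<b)))

  lower-upper-disjoint : Or a x b → Or a y x → ¬ Or x y b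
  lower-upper-disjoint {a} {x} {b} {y} a<x<b a<y<x x<y<b =
    asym a x b a<x<b (rotate (rotate (transitive x a y b (rotate (rotate a<y<x)) x<y<b)))

  record DisjointIntervals (n : ℕ) (a b : A) : Set where
    field
      lo hi point : Fin n → A
      point-inside : ∀ k → Or (lo k) (point k) (hi k)
      inside-⊆ : ∀ k {y} → Or (lo k) y (hi k) → Or a y b
      disjoint : ∀ {k l} → k ≢ l → ∀ {y} → Or (lo k) y (hi k) → ¬ Or (lo l) y (hi l)

    inside-unique : ∀ {k l y} → Or (lo k) y (hi k) → Or (lo l) y (hi l) → k ≡ l
    inside-unique {k} {l} y∈k y∈l with k ≟ l
    ... | yes k≡l = k≡l
    ... | no k≢l = contradiction y∈l (disjoint k≢l y∈k)

  -- The first interval is (a, x); the others are built recursively inside (x, b).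
  disjointIntervals : Dense → ∀ n → Or a x b → DisjointIntervals n a b
  disjointIntervals dense zero a<x<b = record
    { lo = λ () ; hi = λ () ; point = λ ()
    ; point-inside = λ () ; inside-⊆ = λ () ; disjoint = λ { {()} } }
  disjointIntervals {a} {x} {b} dense (suc n) a<x<b = record
    { lo = a ∷ I.lo ; hi = x ∷ I.hi ; point = proj₁ first ∷ I.point
    ; point-inside = point-inside ; inside-⊆ = inside-⊆ ; disjoint = disjoint }
    where
    first : Σ[ y ∈ A ] Or a y x
    first = dense (rotate (rotate a<x<b))
    rest : Σ[ y ∈ A ] Or x y b
    rest = dense a<x<b
    module I = DisjointIntervals (disjointIntervals dense n (proj₂ rest))
    point-inside : ∀ k → Or ((a ∷ I.lo) k) ((proj₁ first ∷ I.point) k) ((x ∷ I.hi) k)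
    point-inside zero = proj₂ first
    point-inside (suc k) = I.point-inside k
    inside-⊆ : ∀ k {y} → Or ((a ∷ I.lo) k) y ((x ∷ I.hi) k) → Or a y b
    inside-⊆ zero = lower-⊆ a<x<b
    inside-⊆ (suc k) y∈k = upper-⊆ a<x<b (I.inside-⊆ k y∈k)
    disjoint : ∀ {k l} → k ≢ l → ∀ {y} →
               Or ((a ∷ I.lo) k) y ((x ∷ I.hi) k) → ¬ Or ((a ∷ I.lo) l) y ((x ∷ I.hi) l)
    disjoint {zero} {zero} 0≢0 = contradiction refl 0≢0
    disjoint {zero} {suc l} _ y∈0 y∈l = lower-upper-disjoint a<x<b y∈0 (I.inside-⊆ l y∈l)
    disjoint {suc k} {zero} _ y∈k y∈0 = lower-upper-disjoint a<x<b y∈0 (I.inside-⊆ k y∈k)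
    disjoint {suc k} {suc l} k≢l = I.disjoint (λ k≡l → k≢l (cong suc k≡l))

module OrientedAbelianGroup (M : LStr) (oag : IsOrientedAbGroup M) where
  open LStr M
  open IsOrientedAbGroup oag
  open ≡-Reasoning
  open CyclicOrder Or O-cyclic O-asym O-trans public

  ⊕-identityˡ : ∀ a → 𝟎 ⊕ a ≡ a
  ⊕-identityˡ a = begin 𝟎 ⊕ a ≡⟨ +-comm 𝟎 a ⟩ a ⊕ 𝟎 ≡⟨ +-identity a ⟩ a ∎

  ⊖-inverseˡ : ∀ a → ⊖ a ⊕ a ≡ 𝟎
  ⊖-inverseˡ a = begin ⊖ a ⊕ a ≡⟨ +-comm (⊖ a) a ⟩ a ⊕ ⊖ a ≡⟨ +-inverse a ⟩ 𝟎 ∎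

  ⊖-cancelʳ : ∀ a b → (a ⊕ ⊖ b) ⊕ b ≡ a
  ⊖-cancelʳ a b = begin
    (a ⊕ ⊖ b) ⊕ b   ≡⟨ +-assoc a (⊖ b) b ⟩
    a ⊕ (⊖ b ⊕ b)   ≡⟨ cong (a ⊕_) (⊖-inverseˡ b) ⟩
    a ⊕ 𝟎           ≡⟨ +-identity a ⟩
    a               ∎

  ⊕-cancelʳ : ∀ a b → (a ⊕ b) ⊕ ⊖ b ≡ a
  ⊕-cancelʳ a b = begin
    (a ⊕ b) ⊕ ⊖ b   ≡⟨ +-assoc a b (⊖ b) ⟩
    a ⊕ (b ⊕ ⊖ b)   ≡⟨ cong (a ⊕_) (+-inverse b) ⟩
    a ⊕ 𝟎           ≡⟨ +-identity a ⟩
    a               ∎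

  ⊖-cancelˡ : ∀ a b c → ⊖ a ⊕ ((a ⊕ b) ⊕ c) ≡ b ⊕ c
  ⊖-cancelˡ a b c = begin
    ⊖ a ⊕ ((a ⊕ b) ⊕ c)   ≡⟨ cong (⊖ a ⊕_) (+-assoc a b c) ⟩
    ⊖ a ⊕ (a ⊕ (b ⊕ c))   ≡⟨ +-assoc (⊖ a) a (b ⊕ c) ⟨
    (⊖ a ⊕ a) ⊕ (b ⊕ c)   ≡⟨ cong (_⊕ (b ⊕ c)) (⊖-inverseˡ a) ⟩
    𝟎 ⊕ (b ⊕ c)           ≡⟨ ⊕-identityˡ (b ⊕ c) ⟩
    b ⊕ c                 ∎

  Or-translate⁻¹ : ∀ {a b c} e → Or (a ⊕ ⊖ e) b (c ⊕ ⊖ e) → Or a (b ⊕ e) c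
  Or-translate⁻¹ {a} {b} {c} e h =
    subst₂ (λ a′ c′ → Or a′ (b ⊕ e) c′) (⊖-cancelʳ a e) (⊖-cancelʳ c e)
      (O-transl (a ⊕ ⊖ e) b (c ⊕ ⊖ e) e h)

  Or-translate-to-𝟎 : ∀ {e a b} → Or e a b → Or 𝟎 (a ⊕ ⊖ e) (b ⊕ ⊖ e)
  Or-translate-to-𝟎 {e} {a} {b} e<a<b =
    subst (λ z → Or z (a ⊕ ⊖ e) (b ⊕ ⊖ e)) (+-inverse e) (O-transl e a b (⊖ e) e<a<b)

  regDense⇒dense : RegDenseIn M (All M) → Dense
  regDense⇒dense regDense {e} e<a<b =
    let c , _ , a-e<2c<b-e , _ = regDense 2 prime[2] _ _ _ _ (Or-translate-to-𝟎 e<a<b)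
    in 2 · c ⊕ e , Or-translate⁻¹ e a-e<2c<b-e

module DenseSubgroup (M : LStr) (oag : IsOrientedAbGroup M) (subgroup : IsSubgroup M) where
  open LStr M
  open IsOrientedAbGroup oag
  open OrientedAbelianGroup M oag

  V-𝟎 : V 𝟎
  V-𝟎 = proj₁ subgroup

  V-⊕ : ∀ {a b} → V a → V b → V (a ⊕ b)
  V-⊕ = proj₁ (proj₂ subgroup) _ _

  V-⊖ : ∀ {a} → V a → V (⊖ a)
  V-⊖ = proj₂ (proj₂ subgroup) _

  incongruent⇒≢ : ∀ {a b} → ¬ V (a ⊕ ⊖ b) → a ≢ b
  incongruent⇒≢ a≁b refl = a≁b (subst V (sym (+-inverse _)) V-𝟎)

  V-absorbˡ : ∀ {g b c} → V g → V ((g ⊕ b) ⊕ ⊖ c) → V (b ⊕ ⊖ c)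
  V-absorbˡ {g} {b} {c} g∈G h = subst V (⊖-cancelˡ g b (⊖ c)) (V-⊕ (V-⊖ g∈G) h)

  incongruent-unique : ∀ {n} {d : Fin n → Carrier} → (∀ i j → i ≢ j → ¬ V (d i ⊕ ⊖ d j)) →
                       ∀ {g j l} → V g → V ((g ⊕ d j) ⊕ ⊖ d l) → l ≡ j
  incongruent-unique incongruent {j = j} {l} g∈G h with j ≟ l
  ... | yes j≡l = sym j≡l
  ... | no j≢l = contradiction (V-absorbˡ g∈G h) (incongruent j l j≢l)

  cyclicTriple : InfiniteQuot M → Σ[ a ∈ Carrier ] Σ[ x ∈ Carrier ] Σ[ b ∈ Carrier ] Or a x b
  cyclicTriple quot-inf
    with d , incongruent ← quot-inf 3
    with O-total (d zero) (d (suc zero)) (d (suc (suc zero)))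
           (incongruent⇒≢ (incongruent _ _ (λ ())))
           (incongruent⇒≢ (incongruent _ _ (λ ())))
           (incongruent⇒≢ (incongruent _ _ (λ ())))
  ... | inj₁ d₀<d₁<d₂ = _ , _ , _ , d₀<d₁<d₂
  ... | inj₂ d₂<d₁<d₀ = _ , _ , _ , d₂<d₁<d₀

  coset-meets-interval : IsDenseV M → ∀ {u w v} → Or u w v → ∀ d →
                         Σ[ g ∈ Carrier ] V g × Or u (g ⊕ d) v
  coset-meets-interval G-dense {u} {w} {v} u<w<v d =
    let g , g∈G , u-d<g<v-d = G-dense (u ⊕ ⊖ d) (v ⊕ ⊖ d) (w ⊕ ⊖ d) (O-transl u w v (⊖ d) u<w<v)
    in g , g∈G , Or-translate⁻¹ d u-d<g<v-d

  notDPMinimal : RegDenseIn M (All M) → IsDenseV M → InfiniteQuot M → NotDPMinimal M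
  notDPMinimal regDense G-dense quot-inf = 2 , 1 , inInterval , inCoset , λ n →
    let a , x , b , a<x<b = cyclicTriple quot-inf
        open DisjointIntervals (disjointIntervals (regDense⇒dense regDense) n a<x<b)
        d , incongruent = quot-inf n
    in (λ k → lo k ∷ hi k ∷ []) , (λ l → d l ∷ []) , λ i j →
       let g , g∈G , inside-i = coset-meets-interval G-dense (point-inside i) (d j)
       in g ⊕ d j
        , (λ k → mk⇔ (λ inside-k → inside-unique inside-k inside-i) (λ { refl → inside-i }))
        , (λ l → mk⇔ (incongruent-unique incongruent g∈G)
                     (λ { refl → subst V (sym (⊕-cancelʳ g (d j))) g∈G }))
    where
    inInterval : Formula 3
    inInterval = ordF (var (suc zero)) (var zero) (var (suc (suc zero)))
    inCoset : Formula 2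
    inCoset = vF (plus (var zero) (neg (var (suc zero))))

model⇒notDPMinimal : ∀ {e₁ e₂ M} → ModelT e₁ e₂ M → NotDPMinimal M
model⇒notDPMinimal {M = M} model =
  DenseSubgroup.notDPMinimal M isOAG G-subgroup A-regdense G-dense quot-inf
  where open ModelT model

proposition3p11 :
    (∀ (M : LStr) → ModelT e0 e0 M → NotDPMinimal M) ×
    (∀ (M : LStr) → ModelT e∞ e0 M → NotDPMinimal M) ×
    (∀ (M : LStr) → ModelT e∞ e∞ M → NotDPMinimal M)
proposition3p11 =
  (λ _ → model⇒notDPMinimal) , (λ _ → model⇒notDPMinimal) , (λ _ → model⇒notDPMinimal)
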